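{- For $n\ge 1$ and integers $i$, let $s_{n,i}$ be the number of simple $n$-braids of length $i$ (so $s_{n,i}=0$ unless $0\le i\le n-1$). Then for all $n\ge 3$ and $0\le i\le n-1$, $$s_{n,i}=2s_{n-1,i-1}+s_{n-1,i}-s_{n-2,i-1}.$$
   Context: The monoid of positive $n$-braids $\mathcal{MB}_n$ is the monoid with generators $x_1,\dots,x_{n-1}$ and relations $x_ix_j=x_jx_i$ for $|i-j|\ge 2$ and $x_ix_{i+1}x_i=x_{i+1}x_ix_{i+1}$ for $1\le i\le n-2$; word length is well defined on it. A simple braid is a positive braid $\beta\in\mathcal{MB}_n$ that can be represented by a positive word in which each letter $x_i$ occurs at most once. -}

module Defs where

open import Data.Nat using (ℕ; zero; suc; _≤_; _∸_)
open import Data.Fin using (Fin; toℕ)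
open import Data.List using (List; []; _∷_; _++_; length)
open import Data.List.Relation.Unary.Unique.Propositional using (Unique)
open import Data.List.Relation.Unary.AllPairs using (AllPairs)
open import Data.List.Relation.Unary.All using (All)
open import Data.List.Relation.Unary.Any using (Any)
open import Data.Product using (_×_)
open import Relation.Binary.PropositionalEquality using (_≡_)
open import Relation.Binary.Construct.Closure.ReflexiveTransitive using (Star)
open import Relation.Binary.Construct.Closure.Symmetric using (SymClosure)
open import Relation.Nullary using (¬_)

-- Positive words for n-braids: lists of generators x_1..x_{n-1},
-- generator x_{k+1} encoded as k : Fin (n ∸ 1).
Word : ℕ → Set
Word n = List (Fin (n ∸ 1))

data Step {n : ℕ} : Word n → Word n → Set where
  comm  : (u v : Word n) (a b : Fin (n ∸ 1)) →
          suc (suc (toℕ a)) ≤ toℕ b →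
          Step (u ++ a ∷ b ∷ v) (u ++ b ∷ a ∷ v)
  braid : (u v : Word n) (a b : Fin (n ∸ 1)) →
          toℕ b ≡ suc (toℕ a) →
          Step (u ++ a ∷ b ∷ a ∷ v) (u ++ b ∷ a ∷ b ∷ v)

BraidEq : (n : ℕ) → Word n → Word n → Set
BraidEq n = Star (SymClosure (Step {n}))

SimpleWord : {n : ℕ} → Word n → Set
SimpleWord w = Unique w

SimpleWordOfLength : (n i : ℕ) → Word n → Set
SimpleWordOfLength n i w = SimpleWord {n} w × length w ≡ i

-- IsSimpleCount n i k : the number of simple n-braids of length i is k,
-- witnessed by a list of k simple words of length i representing pairwise
-- distinct braids, such that every simple word of length i represents
-- one of these braids.
record IsSimpleCount (n i k : ℕ) : Set where
  field
    reps     : List (Word n)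
    repsLen  : length reps ≡ k
    repsOk   : All (SimpleWordOfLength n i) reps
    distinct : AllPairs (λ x y → ¬ BraidEq n x y) reps
    covers   : (w : Word n) → SimpleWordOfLength n i w → Any (λ r → BraidEq n w r) reps

-- Count at length i - 1, with the convention s_{n,-1} = 0.
IsSimpleCountPred : (n i k : ℕ) → Set
IsSimpleCountPred n zero    k = k ≡ 0
IsSimpleCountPred n (suc j) k = IsSimpleCount n j k

-- A simple braid is represented by a positive word without repeated generators.  Neither
-- side of a braid relation x_a x_b x_a = x_b x_a x_b is such a word, so on simple words the
-- defining relations only commute far generators.  Hence two simple words are equivalent iff
-- they have the same signature: the same set of generators and the same relative order of
-- every adjacent pair x_k, x_{k+1} (braidEq-preserves, sameSignature⇒braidEq).
-- A signature in MB_{m+1} is recorded by a code, one letter per generator saying whether it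
-- is absent, present, or present and in front of its right neighbour; encode and decode show
-- that signatures of simple words correspond to valid codes.  So s_{m+1,i} is the number of
-- valid codes of length m with i present generators (simple-braid-count).
module Submission where

open import Defs
open import Data.Nat using (ℕ; zero; suc; _≤_; _∸_; _+_; _*_; s≤s)
open import Data.Nat.Properties
  using (+-comm; <-cmp; m≤n⇒m<n∨m≡n; suc-injective; +-identityʳ; <⇒≱; ≤-reflexive; ≤-trans; n≤1+n)
open import Data.Nat.Solver using (module +-*-Solver)
open import Data.Fin using (Fin; toℕ) renaming (zero to fz; suc to fs)
open import Data.Fin.Properties using (toℕ-injective) renaming (_≟_ to _≟ᶠ_; suc-injective to fs-injective)
open import Data.List using (List; []; _∷_; _++_; length; map; [_])
open import Data.List.Properties using (length-map; length-++; ∷-injectiveˡ; ∷-injectiveʳ)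
open import Data.List.Relation.Unary.Any using (here; there; any?)
open import Data.List.Relation.Unary.All as All using (All; []; _∷_)
open import Data.List.Relation.Unary.AllPairs as AllPairs using (AllPairs; []; _∷_)
import Data.List.Relation.Unary.AllPairs.Properties as AllPairsₚ
open import Data.List.Relation.Unary.Unique.Propositional using (Unique)
import Data.List.Relation.Unary.Unique.Propositional.Properties as Unique
open import Data.List.Membership.Propositional using (_∈_; _∉_; find)
open import Data.List.Membership.Propositional.Properties
  using (∈-∃++; ∈-map⁺; ∈-map⁻; ∈-++⁺ˡ; ∈-++⁺ʳ; ∈-++⁻)
open import Data.List.Membership.Propositional.Properties.WithK using (unique∧set⇒bag)
open import Data.List.Relation.Binary.BagAndSetEquality using (∼bag⇒↭)
open import Data.List.Relation.Binary.Permutation.Propositional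
  using (_↭_; ↭-sym; ↭-swap; ↭-refl; ↭⇒↭ₛ)
open import Data.List.Relation.Binary.Permutation.Propositional.Properties as ↭
  using (↭-length; ∈-resp-↭; shift; ++⁺ˡ)
import Data.List.Relation.Binary.Permutation.Setoid.Properties as Perm
open import Data.List.Relation.Unary.All.Properties using (¬Any⇒All¬)
open import Data.Product using (Σ; _×_; _,_; proj₁; proj₂)
open import Data.Sum using (_⊎_; inj₁; inj₂)
open import Data.Empty using (⊥; ⊥-elim)
open import Data.Unit using (⊤; tt)
open import Function using (_∘_)
open import Function.Bundles using (mk⇔)
open import Relation.Nullary using (¬_; Dec; yes; no)
open import Relation.Binary using (tri<; tri≈; tri>; DecidableEquality)
open import Relation.Binary.PropositionalEquality
  using (_≡_; _≢_; refl; sym; trans; cong; cong₂; subst; subst₂; setoid; module ≡-Reasoning)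
open import Relation.Binary.Construct.Closure.ReflexiveTransitive using (ε; _◅_; _◅◅_)
open import Relation.Binary.Construct.Closure.Symmetric using (SymClosure; fwd; bwd)
import Relation.Binary.Construct.Closure.ReflexiveTransitive as Star
import Relation.Binary.Construct.Closure.Symmetric as Sym

module _ {A : Set} where

  same-members⇒same-length : ∀ {xs ys : List A} → Unique xs → Unique ys →
    (∀ {z} → z ∈ xs → z ∈ ys) → (∀ {z} → z ∈ ys → z ∈ xs) → length xs ≡ length ys
  same-members⇒same-length uxs uys to from =
    ↭-length (∼bag⇒↭ (unique∧set⇒bag uxs uys (mk⇔ to from)))

  unique-resp-↭ : ∀ {xs ys : List A} → xs ↭ ys → Unique xs → Unique ys
  unique-resp-↭ σ = Perm.Unique-resp-↭ (setoid A) (↭⇒↭ₛ σ)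

  unique-remove : ∀ p {y : A} q → Unique (p ++ y ∷ q) → y ∉ p ++ q × Unique (p ++ q)
  unique-remove p {y} q u with unique-resp-↭ (shift y p q) u
  ... | y∉ ∷ u′ = (λ y∈ → All.lookup y∉ y∈ refl) , u′

  ∈-remove : ∀ p {y z : A} q → z ≢ y → z ∈ p ++ y ∷ q → z ∈ p ++ q
  ∈-remove p {y} q z≢y z∈ with ∈-resp-↭ (shift y p q) z∈
  ... | here z≡y = ⊥-elim (z≢y z≡y)
  ... | there z∈′ = z∈′

  ∈-insert : ∀ p {y z : A} q → z ∈ p ++ q → z ∈ p ++ y ∷ q
  ∈-insert p {y} q z∈ = ∈-resp-↭ (↭-sym (shift y p q)) (there z∈)

  unique-cons : ∀ {x : A} {xs} → x ∉ xs → Unique xs → Unique (x ∷ xs)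
  unique-cons {xs = xs} x∉ u = ¬Any⇒All¬ xs x∉ ∷ u

  unique-snoc : ∀ {x : A} {xs} → Unique xs → x ∉ xs → Unique (xs ++ [ x ])
  unique-snoc {x} {xs} u x∉ = unique-resp-↭ (↭.++-comm [ x ] xs) (unique-cons x∉ u)

  swap↭ : ∀ u {a b : A} {v} → u ++ a ∷ b ∷ v ↭ u ++ b ∷ a ∷ v
  swap↭ u {a} {b} = ++⁺ˡ u (↭-swap a b ↭-refl)

  allPairs-under : ∀ {P : A → Set} {R S : A → A → Set} {xs} → All P xs →
    (∀ {x y} → P x → P y → R x y → S x y) → AllPairs R xs → AllPairs S xs
  allPairs-under [] f [] = []
  allPairs-under (px ∷ pxs) f (rx ∷ rxs) =
    All.zipWith (λ (py , rxy) → f px py rxy) (pxs , rx) ∷ allPairs-under pxs f rxs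

  data Before (a b : A) : List A → Set where
    here  : ∀ {w} → b ∈ w → Before a b (a ∷ w)
    there : ∀ {x w} → Before a b w → Before a b (x ∷ w)

  before-fst : ∀ {a b w} → Before a b w → a ∈ w
  before-fst (here _) = here refl
  before-fst (there bf) = there (before-fst bf)

  before-snd : ∀ {a b w} → Before a b w → b ∈ w
  before-snd (here b∈) = there b∈
  before-snd (there bf) = there (before-snd bf)

  before-asym : ∀ {a b w} → Unique w → Before a b w → ¬ Before b a w
  before-asym (a∉ ∷ _) (here _) (here b∈) = All.lookup a∉ b∈ refl
  before-asym (a∉ ∷ _) (here _) (there bf) = All.lookup a∉ (before-snd bf) refl
  before-asym (b∉ ∷ _) (there bf) (here _) = All.lookup b∉ (before-snd bf) refl
  before-asym (_ ∷ u) (there bf) (there bf′) = before-asym u bf bf′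

  before-mid : ∀ p {z y : A} q → z ∈ p → Before z y (p ++ y ∷ q)
  before-mid (_ ∷ p) q (here refl) = here (∈-++⁺ʳ p (here refl))
  before-mid (_ ∷ p) q (there z∈) = there (before-mid p q z∈)

  before-head : ∀ {a b y : A} {w} → a ≢ y → Before a b (y ∷ w) → Before a b w
  before-head a≢y (here _) = ⊥-elim (a≢y refl)
  before-head a≢y (there bf) = bf

  before-remove : ∀ p {a b y : A} q → a ≢ y → b ≢ y → Before a b (p ++ y ∷ q) → Before a b (p ++ q)
  before-remove [] q a≢y b≢y bf = before-head a≢y bf
  before-remove (_ ∷ p) q a≢y b≢y (here b∈) = here (∈-remove p q b≢y b∈)
  before-remove (_ ∷ p) q a≢y b≢y (there bf) = there (before-remove p q a≢y b≢y bf)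

  before-insert : ∀ p {a b y : A} q → Before a b (p ++ q) → Before a b (p ++ y ∷ q)
  before-insert [] q bf = there bf
  before-insert (_ ∷ p) q (here b∈) = here (∈-insert p q b∈)
  before-insert (_ ∷ p) q (there bf) = there (before-insert p q bf)

  before-swap : ∀ u {a b c d : A} {v} → ¬ (c ≡ a × d ≡ b) →
                Before c d (u ++ a ∷ b ∷ v) → Before c d (u ++ b ∷ a ∷ v)
  before-swap [] ne (here (here d≡b)) = ⊥-elim (ne (refl , d≡b))
  before-swap [] ne (here (there d∈)) = there (here d∈)
  before-swap [] ne (there (here d∈)) = here (there d∈)
  before-swap [] ne (there (there bf)) = there (there bf)
  before-swap (_ ∷ u) ne (here d∈) = here (∈-resp-↭ (swap↭ u) d∈)
  before-swap (_ ∷ u) ne (there bf) = there (before-swap u ne bf)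

  before-last : ∀ xs {a b : A} → a ∉ xs → ¬ Before a b (xs ++ [ a ])
  before-last [] a∉ (here ())
  before-last [] a∉ (there ())
  before-last (_ ∷ xs) a∉ (here _) = a∉ (here refl)
  before-last (_ ∷ xs) a∉ (there bf) = before-last xs (a∉ ∘ there) bf

  before? : DecidableEquality A → (a b : A) (w : List A) → Dec (Before a b w)
  before? _≟_ a b [] = no λ ()
  before? _≟_ a b (x ∷ w) with before? _≟_ a b w | x ≟ a | any? (b ≟_) w
  ... | yes bf | _      | _      = yes (there bf)
  ... | no _   | yes refl | yes b∈ = yes (here b∈)
  ... | no ¬bf | yes refl | no b∉  = no λ { (here b∈) → b∉ b∈ ; (there bf) → ¬bf bf }
  ... | no ¬bf | no x≢a | _      = no λ { (here _) → x≢a refl ; (there bf) → ¬bf bf }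

-- Words in MB_{m+1} are lists over Fin m, the element k standing for the generator x_{k+1}.
-- Adj a b : b is the right neighbour of a, so a and b satisfy the braid relation.
Adj : ∀ {m} → Fin m → Fin m → Set
Adj a b = toℕ b ≡ suc (toℕ a)

Far : ∀ {m} → Fin m → Fin m → Set
Far a b = a ≢ b × ¬ Adj a b × ¬ Adj b a

far-sym : ∀ {m} {a b : Fin m} → Far a b → Far b a
far-sym (a≢b , ¬ab , ¬ba) = (a≢b ∘ sym) , ¬ba , ¬ab

gap⇒far : ∀ {m} {a b : Fin m} → suc (suc (toℕ a)) ≤ toℕ b → Far a b
gap⇒far gap =
  (λ { refl → <⇒≱ gap (n≤1+n _) }) ,
  (λ ab → <⇒≱ gap (≤-reflexive ab)) ,
  (λ ba → <⇒≱ gap (≤-trans (n≤1+n _) (≤-trans (≤-reflexive (sym ba)) (n≤1+n _))))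

commute : ∀ {m} {a b : Fin m} {w} → Far a b → SymClosure (Step {suc m}) (a ∷ b ∷ w) (b ∷ a ∷ w)
commute {a = a} {b} {w} (a≢b , ¬ab , ¬ba) with <-cmp (toℕ a) (toℕ b)
... | tri< a<b _ _ with m≤n⇒m<n∨m≡n a<b
...   | inj₁ gap = fwd (comm [] w a b gap)
...   | inj₂ ab  = ⊥-elim (¬ab (sym ab))
commute {a = a} {b} {w} (a≢b , ¬ab , ¬ba) | tri≈ _ a≡b _ = ⊥-elim (a≢b (toℕ-injective a≡b))
commute {a = a} {b} {w} (a≢b , ¬ab , ¬ba) | tri> _ _ b<a with m≤n⇒m<n∨m≡n b<a
...   | inj₁ gap = bwd (comm [] w b a gap)
...   | inj₂ ba  = ⊥-elim (¬ba (sym ba))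

record _⊑_ {m} (w w′ : List (Fin m)) : Set where
  field
    members : ∀ {z} → z ∈ w → z ∈ w′
    order   : ∀ {a b} → Adj a b → Before a b w → Before a b w′
open _⊑_

SameSignature : ∀ {m} → List (Fin m) → List (Fin m) → Set
SameSignature w w′ = w ⊑ w′ × w′ ⊑ w

⊑-refl : ∀ {m} {w : List (Fin m)} → w ⊑ w
⊑-refl = record { members = λ z∈ → z∈ ; order = λ _ bf → bf }

⊑-trans : ∀ {m} {w w′ w″ : List (Fin m)} → w ⊑ w′ → w′ ⊑ w″ → w ⊑ w″
⊑-trans s t = record { members = members t ∘ members s ; order = λ ab → order t ab ∘ order s ab }

data FarSwap {m} : List (Fin m) → List (Fin m) → Set where
  farSwap : ∀ u v {a b} → Far a b → FarSwap (u ++ a ∷ b ∷ v) (u ++ b ∷ a ∷ v)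

farSwap-sym : ∀ {m} {w w′ : List (Fin m)} → FarSwap w w′ → FarSwap w′ w
farSwap-sym (farSwap u v f) = farSwap u v (far-sym f)

braid-not-simple : ∀ {A : Set} u {a b : A} {v} → ¬ Unique (u ++ a ∷ b ∷ a ∷ v)
braid-not-simple u un = proj₁ (unique-remove u _ un) (∈-++⁺ʳ u (there (here refl)))

step-on-simple : ∀ {m} {w w′ : List (Fin m)} → Step {suc m} w w′ → Unique w ⊎ Unique w′ →
                 FarSwap w w′
step-on-simple (comm u v a b gap) _ = farSwap u v (gap⇒far gap)
step-on-simple (braid u v a b _) (inj₁ un) = ⊥-elim (braid-not-simple u un)
step-on-simple (braid u v a b _) (inj₂ un) = ⊥-elim (braid-not-simple u un)

swap-⊑ : ∀ {m} u {a b : Fin m} {v} → ¬ Adj a b → (u ++ a ∷ b ∷ v) ⊑ (u ++ b ∷ a ∷ v)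
swap-⊑ u ¬ab = record
  { members = ∈-resp-↭ (swap↭ u)
  ; order   = λ cd → before-swap u (λ { (refl , refl) → ¬ab cd }) }

farSwap-preserves : ∀ {m} {w w′ : List (Fin m)} → FarSwap w w′ → Unique w →
                    Unique w′ × SameSignature w w′
farSwap-preserves (farSwap u v (_ , ¬ab , ¬ba)) un =
  unique-resp-↭ (swap↭ u) un , swap-⊑ u ¬ab , swap-⊑ u ¬ba

braidEq-preserves : ∀ {m} {w w′ : List (Fin m)} → BraidEq (suc m) w w′ → Unique w →
                    Unique w′ × SameSignature w w′
braidEq-preserves ε un = un , ⊑-refl , ⊑-refl
braidEq-preserves {w = w} (s ◅ ss) un =
  let (un′ , to′ , from′) = farSwap-preserves (farSwap-of s) un
      (un″ , to″ , from″) = braidEq-preserves ss un′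
  in un″ , ⊑-trans to′ to″ , ⊑-trans from″ from′
  where
  farSwap-of : ∀ {w₁} → SymClosure Step w w₁ → FarSwap w w₁
  farSwap-of (fwd s) = step-on-simple s (inj₁ un)
  farSwap-of (bwd s) = farSwap-sym (step-on-simple s (inj₂ un))

step-cons : ∀ {n} {w w′ : Word n} x → Step {n} w w′ → Step {n} (x ∷ w) (x ∷ w′)
step-cons x (comm u v a b gap) = comm (x ∷ u) v a b gap
step-cons x (braid u v a b ab) = braid (x ∷ u) v a b ab

braidEq-cons : ∀ {n} {w w′ : Word n} x → BraidEq n w w′ → BraidEq n (x ∷ w) (x ∷ w′)
braidEq-cons {n} x = Star.gmap (x ∷_) (Sym.gmap (x ∷_) (step-cons {n} x))

move-to-front : ∀ {m} {y : Fin m} p {q} → All (λ z → Far z y) p →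
                BraidEq (suc m) (p ++ y ∷ q) (y ∷ p ++ q)
move-to-front [] [] = ε
move-to-front (z ∷ p) (far ∷ fars) = braidEq-cons z (move-to-front p fars) ◅◅ (commute far ◅ ε)

module _ {m} {y : Fin m} (p q r : List (Fin m)) (u : Unique (p ++ y ∷ q)) (u′ : Unique (y ∷ r))
         (same : SameSignature (p ++ y ∷ q) (y ∷ r)) where

  private
    y∉pq : y ∉ p ++ q
    y∉pq = proj₁ (unique-remove p q u)

    y∉r : y ∉ r
    y∉r y∈ = All.lookup (AllPairs.head u′) y∈ refl

    ≢y-pq : ∀ {z} → z ∈ p ++ q → z ≢ y
    ≢y-pq z∈ refl = y∉pq z∈

    ≢y-r : ∀ {z} → z ∈ r → z ≢ y
    ≢y-r z∈ refl = y∉r z∈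

    pq⊆r : ∀ {z} → z ∈ p ++ q → z ∈ r
    pq⊆r z∈ with members (proj₁ same) (∈-insert p q z∈)
    ... | here z≡y = ⊥-elim (≢y-pq z∈ z≡y)
    ... | there z∈r = z∈r

  prefix-far : All (λ z → Far z y) p
  prefix-far = All.tabulate λ {z} z∈p →
    let z≢y = ≢y-pq (∈-++⁺ˡ z∈p)
        z<y = before-mid p q z∈p
    in z≢y
     , (λ zy → y∉r (before-snd (before-head z≢y (order (proj₁ same) zy z<y))))
     , (λ yz → before-asym u z<y (order (proj₂ same) yz (here (pq⊆r (∈-++⁺ˡ z∈p)))))

  remove-common : SameSignature (p ++ q) r
  remove-common =
    record { members = pq⊆r
           ; order = λ ab a<b → before-head (≢y-pq (before-fst a<b))
                                  (order (proj₁ same) ab (before-insert p q a<b)) } ,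
    record { members = λ z∈ → ∈-remove p q (≢y-r z∈) (members (proj₂ same) (there z∈))
           ; order = λ ab a<b → before-remove p q (≢y-r (before-fst a<b)) (≢y-r (before-snd a<b))
                                  (order (proj₂ same) ab (there a<b)) }

sameSignature⇒braidEq : ∀ {m} (w w′ : List (Fin m)) → Unique w → Unique w′ → SameSignature w w′ →
                        BraidEq (suc m) w w′
sameSignature⇒braidEq [] [] _ _ _ = ε
sameSignature⇒braidEq (x ∷ w) [] _ _ same with members (proj₁ same) (here refl)
... | ()
sameSignature⇒braidEq w (y ∷ r) u u′@(_ ∷ ur) same with ∈-∃++ (members (proj₂ same) (here refl))
... | p , q , refl =
  move-to-front p (prefix-far p q r u u′ same) ◅◅
  braidEq-cons y (sameSignature⇒braidEq (p ++ q) r (proj₂ (unique-remove p q u)) ur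
                                        (remove-common p q r u u′ same))

FirstLeads : ∀ {m} → List (Fin (suc m)) → Set
FirstLeads {zero}  w = ⊥
FirstLeads {suc m} w = Before fz (fs fz) w

firstLeads? : ∀ {m} (w : List (Fin (suc m))) → Dec (FirstLeads w)
firstLeads? {zero}  w = no λ ()
firstLeads? {suc m} w = before? _≟ᶠ_ fz (fs fz) w

firstLeads⇒∈ : ∀ {m} {w : List (Fin (suc m))} → FirstLeads w → fz ∈ w
firstLeads⇒∈ {suc m} = before-fst

firstLeads-⊑ : ∀ {m} {w w′ : List (Fin (suc m))} → w ⊑ w′ → FirstLeads w → FirstLeads w′
firstLeads-⊑ {suc m} s = order s refl

-- A code records a signature letter by letter: for each generator x_k, whether it is
-- absent, present, or present and in front of x_{k+1}.
data Letter : Set where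
  absent present leads : Letter

Code : Set
Code = List Letter

data Describes {m} (w : List (Fin (suc m))) : Letter → Set where
  absent  : fz ∉ w → Describes w absent
  present : fz ∈ w → ¬ FirstLeads w → Describes w present
  leads   : FirstLeads w → Describes w leads

describe : ∀ {m} (w : List (Fin (suc m))) → Σ Letter (Describes w)
describe w with any? (fz ≟ᶠ_) w | firstLeads? w
... | no fz∉ | _      = absent , absent fz∉
... | yes fz∈ | no ¬l = present , present fz∈ ¬l
... | yes _ | yes l   = leads , leads l

firstLetter : ∀ {m} → List (Fin (suc m)) → Letter
firstLetter w = proj₁ (describe w)

describes-firstLetter : ∀ {m} (w : List (Fin (suc m))) → Describes w (firstLetter w)
describes-firstLetter w = proj₂ (describe w)

describes-functional : ∀ {m} {w : List (Fin (suc m))} {ℓ ℓ′} →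
                       Describes w ℓ → Describes w ℓ′ → ℓ ≡ ℓ′
describes-functional (absent _) (absent _) = refl
describes-functional (absent fz∉) (present fz∈ _) = ⊥-elim (fz∉ fz∈)
describes-functional (absent fz∉) (leads l) = ⊥-elim (fz∉ (firstLeads⇒∈ l))
describes-functional (present fz∈ _) (absent fz∉) = ⊥-elim (fz∉ fz∈)
describes-functional (present _ _) (present _ _) = refl
describes-functional (present _ ¬l) (leads l) = ⊥-elim (¬l l)
describes-functional (leads l) (absent fz∉) = ⊥-elim (fz∉ (firstLeads⇒∈ l))
describes-functional (leads l) (present _ ¬l) = ⊥-elim (¬l l)
describes-functional (leads _) (leads _) = refl

firstLetter-unique : ∀ {m} {w : List (Fin (suc m))} {ℓ} → Describes w ℓ → firstLetter w ≡ ℓ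
firstLetter-unique d = describes-functional (describes-firstLetter _) d

describes-same : ∀ {m} {w w′ : List (Fin (suc m))} {ℓ} → SameSignature w w′ →
                 Describes w ℓ → Describes w′ ℓ
describes-same (to , from) (absent fz∉) = absent (fz∉ ∘ members from)
describes-same (to , from) (present fz∈ ¬l) = present (members to fz∈) (¬l ∘ firstLeads-⊑ from)
describes-same (to , from) (leads l) = leads (firstLeads-⊑ to l)

describes-transfer : ∀ {m} {w w′ : List (Fin (suc m))} {ℓ} → Describes w ℓ → Describes w′ ℓ →
                     (fz ∈ w → fz ∈ w′) × (FirstLeads w → FirstLeads w′)
describes-transfer (absent fz∉) _ = (⊥-elim ∘ fz∉) , (⊥-elim ∘ fz∉ ∘ firstLeads⇒∈)
describes-transfer (present _ ¬l) (present fz∈ _) = (λ _ → fz∈) , (⊥-elim ∘ ¬l)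
describes-transfer (leads _) (leads l) = (λ _ → firstLeads⇒∈ l) , (λ _ → l)

shiftDown : ∀ {m} → List (Fin (suc m)) → List (Fin m)
shiftDown [] = []
shiftDown (fz ∷ w) = shiftDown w
shiftDown (fs k ∷ w) = k ∷ shiftDown w

∈-shiftDown⁺ : ∀ {m} {k : Fin m} w → fs k ∈ w → k ∈ shiftDown w
∈-shiftDown⁺ (fz ∷ w) (there k∈) = ∈-shiftDown⁺ w k∈
∈-shiftDown⁺ (fs _ ∷ w) (here refl) = here refl
∈-shiftDown⁺ (fs _ ∷ w) (there k∈) = there (∈-shiftDown⁺ w k∈)

∈-shiftDown⁻ : ∀ {m} {k : Fin m} w → k ∈ shiftDown w → fs k ∈ w
∈-shiftDown⁻ (fz ∷ w) k∈ = there (∈-shiftDown⁻ w k∈)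
∈-shiftDown⁻ (fs _ ∷ w) (here refl) = here refl
∈-shiftDown⁻ (fs _ ∷ w) (there k∈) = there (∈-shiftDown⁻ w k∈)

before-shiftDown⁺ : ∀ {m} {a b : Fin m} w → Before (fs a) (fs b) w → Before a b (shiftDown w)
before-shiftDown⁺ (fz ∷ w) (there bf) = before-shiftDown⁺ w bf
before-shiftDown⁺ (fs _ ∷ w) (here b∈) = here (∈-shiftDown⁺ w b∈)
before-shiftDown⁺ (fs _ ∷ w) (there bf) = there (before-shiftDown⁺ w bf)

before-shiftDown⁻ : ∀ {m} {a b : Fin m} w → Before a b (shiftDown w) → Before (fs a) (fs b) w
before-shiftDown⁻ (fz ∷ w) bf = there (before-shiftDown⁻ w bf)
before-shiftDown⁻ (fs _ ∷ w) (here b∈) = here (∈-shiftDown⁻ w b∈)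
before-shiftDown⁻ (fs _ ∷ w) (there bf) = there (before-shiftDown⁻ w bf)

⊑-shiftDown : ∀ {m} {w w′ : List (Fin (suc m))} → w ⊑ w′ → shiftDown w ⊑ shiftDown w′
⊑-shiftDown {w = w} {w′} s = record
  { members = ∈-shiftDown⁺ w′ ∘ members s ∘ ∈-shiftDown⁻ w
  ; order   = λ ab → before-shiftDown⁺ w′ ∘ order s (cong suc ab) ∘ before-shiftDown⁻ w }

⊑-shiftUp : ∀ {m} {w w′ : List (Fin (suc m))} → firstLetter w ≡ firstLetter w′ →
            shiftDown w ⊑ shiftDown w′ → w ⊑ w′
⊑-shiftUp {m} {w} {w′} same-first s = record { members = members′ ; order = order′ }
  where
  first : (fz ∈ w → fz ∈ w′) × (FirstLeads w → FirstLeads w′)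
  first = describes-transfer (describes-firstLetter w)
            (subst (Describes w′) (sym same-first) (describes-firstLetter w′))

  members′ : ∀ {z} → z ∈ w → z ∈ w′
  members′ {fz} = proj₁ first
  members′ {fs k} = ∈-shiftDown⁻ w′ ∘ members s ∘ ∈-shiftDown⁺ w

  order′ : ∀ {a b} → Adj a b → Before a b w → Before a b w′
  order′ {fz} {fs fz} _ = proj₂ first
  order′ {fs a} {fs b} ab = before-shiftDown⁻ w′ ∘ order s (suc-injective ab) ∘ before-shiftDown⁺ w
  order′ {fz} {fz} ()
  order′ {fz} {fs (fs _)} ()
  order′ {fs _} {fz} ()

encode : ∀ {m} → List (Fin m) → Code
encode {zero}  w = []
encode {suc m} w = firstLetter w ∷ encode (shiftDown w)

encode-length : ∀ {m} (w : List (Fin m)) → length (encode w) ≡ m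
encode-length {zero}  w = refl
encode-length {suc m} w = cong suc (encode-length (shiftDown w))

encode-same : ∀ {m} {w w′ : List (Fin m)} → SameSignature w w′ → encode w ≡ encode w′
encode-same {zero} _ = refl
encode-same {suc m} {w} {w′} (to , from) =
  cong₂ _∷_ (firstLetter-unique (describes-same (from , to) (describes-firstLetter w′)))
            (encode-same (⊑-shiftDown to , ⊑-shiftDown from))

encode-injective : ∀ {m} {w w′ : List (Fin m)} → encode w ≡ encode w′ → SameSignature w w′
encode-injective {zero} {[]} {[]} _ = ⊑-refl , ⊑-refl
encode-injective {suc m} {w} {w′} eq =
  let (to , from) = encode-injective (∷-injectiveʳ eq)
      first-eq = ∷-injectiveˡ eq
  in ⊑-shiftUp first-eq to , ⊑-shiftUp (sym first-eq) from

HeadPresent : Code → Set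
HeadPresent [] = ⊥
HeadPresent (absent ∷ _) = ⊥
HeadPresent (present ∷ _) = ⊤
HeadPresent (leads ∷ _) = ⊤

Valid : Code → Set
Valid [] = ⊤
Valid (absent ∷ c) = Valid c
Valid (present ∷ c) = Valid c
Valid (leads ∷ c) = HeadPresent c × Valid c

weight : Code → ℕ
weight [] = 0
weight (absent ∷ c) = weight c
weight (present ∷ c) = suc (weight c)
weight (leads ∷ c) = suc (weight c)

∈⇒headPresent : ∀ {m} (w : List (Fin (suc m))) → fz ∈ w → HeadPresent (encode w)
∈⇒headPresent w fz∈ with firstLetter w | describes-firstLetter w
... | absent  | absent fz∉ = fz∉ fz∈
... | present | _ = tt
... | leads   | _ = tt

leads⇒second-present : ∀ {m} (w : List (Fin (suc m))) → FirstLeads w → HeadPresent (encode (shiftDown w))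
leads⇒second-present {suc m} w l = ∈⇒headPresent (shiftDown w) (∈-shiftDown⁺ w (before-snd l))

encode-valid : ∀ {m} (w : List (Fin m)) → Valid (encode w)
encode-valid {zero} w = tt
encode-valid {suc m} w with firstLetter w | describes-firstLetter w
... | absent  | _ = encode-valid (shiftDown w)
... | present | _ = encode-valid (shiftDown w)
... | leads   | leads l = leads⇒second-present w l , encode-valid (shiftDown w)

decode : (m : ℕ) → Code → List (Fin m)
decode zero    _ = []
decode (suc m) [] = []
decode (suc m) (absent ∷ c) = map fs (decode m c)
decode (suc m) (present ∷ c) = map fs (decode m c) ++ [ fz ]
decode (suc m) (leads ∷ c) = fz ∷ map fs (decode m c)

fz∉map-fs : ∀ {m} (w : List (Fin m)) → fz ∉ map fs w
fz∉map-fs (_ ∷ w) (there fz∈) = fz∉map-fs w fz∈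

shiftDown-map-fs : ∀ {m} (w : List (Fin m)) → shiftDown (map fs w) ≡ w
shiftDown-map-fs [] = refl
shiftDown-map-fs (x ∷ w) = cong (x ∷_) (shiftDown-map-fs w)

shiftDown-snoc : ∀ {m} (w : List (Fin (suc m))) → shiftDown (w ++ [ fz ]) ≡ shiftDown w
shiftDown-snoc [] = refl
shiftDown-snoc (fz ∷ w) = shiftDown-snoc w
shiftDown-snoc (fs k ∷ w) = cong (k ∷_) (shiftDown-snoc w)

shiftDown-decode : ∀ m ℓ c → shiftDown (decode (suc m) (ℓ ∷ c)) ≡ decode m c
shiftDown-decode m absent c = shiftDown-map-fs (decode m c)
shiftDown-decode m present c = trans (shiftDown-snoc (map fs (decode m c))) (shiftDown-map-fs (decode m c))
shiftDown-decode m leads c = shiftDown-map-fs (decode m c)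

decode-unique : ∀ m c → Unique (decode m c)
decode-unique zero c = []
decode-unique (suc m) [] = []
decode-unique (suc m) (absent ∷ c) = Unique.map⁺ fs-injective (decode-unique m c)
decode-unique (suc m) (present ∷ c) =
  unique-snoc (Unique.map⁺ fs-injective (decode-unique m c)) (fz∉map-fs (decode m c))
decode-unique (suc m) (leads ∷ c) =
  unique-cons (fz∉map-fs (decode m c)) (Unique.map⁺ fs-injective (decode-unique m c))

decode-length : ∀ m c → length c ≡ m → length (decode m c) ≡ weight c
decode-length zero [] _ = refl
decode-length (suc m) (absent ∷ c) eq =
  trans (length-map fs (decode m c)) (decode-length m c (suc-injective eq))
decode-length (suc m) (present ∷ c) eq = begin
  length (map fs (decode m c) ++ [ fz ])  ≡⟨ length-++ (map fs (decode m c)) ⟩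
  length (map fs (decode m c)) + 1        ≡⟨ +-comm _ 1 ⟩
  suc (length (map fs (decode m c)))      ≡⟨ cong suc (length-map fs (decode m c)) ⟩
  suc (length (decode m c))               ≡⟨ cong suc (decode-length m c (suc-injective eq)) ⟩
  suc (weight c)                          ∎
  where open ≡-Reasoning
decode-length (suc m) (leads ∷ c) eq =
  cong suc (trans (length-map fs (decode m c)) (decode-length m c (suc-injective eq)))

headPresent⇒fz∈ : ∀ m c → HeadPresent c → fz ∈ decode (suc m) c
headPresent⇒fz∈ m (present ∷ c) _ = ∈-++⁺ʳ (map fs (decode m c)) (here refl)
headPresent⇒fz∈ m (leads ∷ c) _ = here refl

describes-decode : ∀ m ℓ c → length c ≡ m → Valid (ℓ ∷ c) →
                   Describes (decode (suc m) (ℓ ∷ c)) ℓ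
describes-decode m absent c _ _ = absent (fz∉map-fs (decode m c))
describes-decode zero present c _ _ = present (here refl) λ ()
describes-decode (suc m) present c _ _ =
  present (∈-++⁺ʳ (map fs (decode (suc m) c)) (here refl))
          (before-last (map fs (decode (suc m) c)) (fz∉map-fs (decode (suc m) c)))
describes-decode zero leads [] _ (() , _)
describes-decode (suc m) leads c _ (head , _) =
  leads (here (∈-map⁺ fs (headPresent⇒fz∈ m c head)))

encode-decode : ∀ m c → length c ≡ m → Valid c → encode (decode m c) ≡ c
encode-decode zero [] _ _ = refl
encode-decode (suc m) (ℓ ∷ c) eq valid =
  cong₂ _∷_ (firstLetter-unique (describes-decode m ℓ c (suc-injective eq) valid))
            (trans (cong encode (shiftDown-decode m ℓ c))
                   (encode-decode m c (suc-injective eq) (valid-tail ℓ valid)))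
  where
  valid-tail : ∀ ℓ {c} → Valid (ℓ ∷ c) → Valid c
  valid-tail absent v = v
  valid-tail present v = v
  valid-tail leads (_ , v) = v

weight-encode : ∀ {m} (w : List (Fin m)) → Unique w → weight (encode w) ≡ length w
weight-encode {m} w u = begin
  weight (encode w)                 ≡⟨ sym (decode-length m (encode w) (encode-length w)) ⟩
  length (decode m (encode w))      ≡⟨ same-members⇒same-length (decode-unique m (encode w)) u
                                         (members (proj₁ same)) (members (proj₂ same)) ⟩
  length w                          ∎
  where
  open ≡-Reasoning
  same : SameSignature (decode m (encode w)) w
  same = encode-injective (encode-decode m (encode w) (encode-length w) (encode-valid w))

mutual
  Codes : ℕ → ℕ → List Code
  Codes zero zero = [ [] ]
  Codes zero (suc i) = []
  Codes (suc m) i = map (absent ∷_) (Codes m i) ++ Headed (suc m) i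

  -- Headed m i : those codes in Codes m i whose first letter is present.
  Headed : ℕ → ℕ → List Code
  Headed zero i = []
  Headed (suc m) zero = []
  Headed (suc m) (suc i) = map (present ∷_) (Codes m i) ++ map (leads ∷_) (Headed m i)

IsCode : ℕ → ℕ → Code → Set
IsCode m i c = length c ≡ m × Valid c × weight c ≡ i

mutual
  Codes-sound : ∀ m i {c} → c ∈ Codes m i → IsCode m i c
  Codes-sound zero zero (here refl) = refl , tt , refl
  Codes-sound (suc m) i c∈ with ∈-++⁻ (map (absent ∷_) (Codes m i)) c∈
  ... | inj₂ c∈H = proj₁ (Headed-sound (suc m) i c∈H)
  ... | inj₁ c∈A with ∈-map⁻ (absent ∷_) c∈A
  ...   | c′ , c′∈ , refl = let (len , valid , wt) = Codes-sound m i c′∈ in cong suc len , valid , wt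

  Headed-sound : ∀ m i {c} → c ∈ Headed m i → IsCode m i c × HeadPresent c
  Headed-sound (suc m) (suc i) c∈ with ∈-++⁻ (map (present ∷_) (Codes m i)) c∈
  ... | inj₁ c∈P with ∈-map⁻ (present ∷_) c∈P
  ...   | c′ , c′∈ , refl = let (len , valid , wt) = Codes-sound m i c′∈
                            in (cong suc len , valid , cong suc wt) , tt
  Headed-sound (suc m) (suc i) c∈ | inj₂ c∈L with ∈-map⁻ (leads ∷_) c∈L
  ...   | c′ , c′∈ , refl = let ((len , valid , wt) , head) = Headed-sound m i c′∈
                            in (cong suc len , (head , valid) , cong suc wt) , tt

mutual
  Codes-complete : ∀ c → Valid c → c ∈ Codes (length c) (weight c)
  Codes-complete [] _ = here refl
  Codes-complete (absent ∷ c) valid = ∈-++⁺ˡ (∈-map⁺ (absent ∷_) (Codes-complete c valid))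
  Codes-complete (present ∷ c) valid =
    ∈-++⁺ʳ (map (absent ∷_) (Codes (length c) (suc (weight c)))) (Headed-complete (present ∷ c) valid tt)
  Codes-complete (leads ∷ c) valid =
    ∈-++⁺ʳ (map (absent ∷_) (Codes (length c) (suc (weight c)))) (Headed-complete (leads ∷ c) valid tt)

  Headed-complete : ∀ c → Valid c → HeadPresent c → c ∈ Headed (length c) (weight c)
  Headed-complete (present ∷ c) valid _ = ∈-++⁺ˡ (∈-map⁺ (present ∷_) (Codes-complete c valid))
  Headed-complete (leads ∷ c) (head , valid) _ =
    ∈-++⁺ʳ (map (present ∷_) (Codes (length c) (weight c)))
           (∈-map⁺ (leads ∷_) (Headed-complete c valid head))

mutual
  Codes-unique : ∀ m i → Unique (Codes m i)
  Codes-unique zero zero = [] ∷ []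
  Codes-unique zero (suc i) = []
  Codes-unique (suc m) i =
    Unique.++⁺ (Unique.map⁺ ∷-injectiveʳ (Codes-unique m i)) (Headed-unique (suc m) i) disjoint
    where
    disjoint : ∀ {c} → ¬ (c ∈ map (absent ∷_) (Codes m i) × c ∈ Headed (suc m) i)
    disjoint (c∈A , c∈H) with ∈-map⁻ (absent ∷_) c∈A
    ... | _ , _ , refl = proj₂ (Headed-sound (suc m) i c∈H)

  Headed-unique : ∀ m i → Unique (Headed m i)
  Headed-unique zero i = []
  Headed-unique (suc m) zero = []
  Headed-unique (suc m) (suc i) =
    Unique.++⁺ (Unique.map⁺ ∷-injectiveʳ (Codes-unique m i))
               (Unique.map⁺ ∷-injectiveʳ (Headed-unique m i)) disjoint
    where
    disjoint : ∀ {c} → ¬ (c ∈ map (present ∷_) (Codes m i) × c ∈ map (leads ∷_) (Headed m i))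
    disjoint (c∈P , c∈L) with ∈-map⁻ (present ∷_) c∈P | ∈-map⁻ (leads ∷_) c∈L
    ... | _ , _ , refl | _ , _ , ()

codeCount : ℕ → ℕ → ℕ
codeCount m i = length (Codes m i)

simple-braid-count : ∀ {m i k} → IsSimpleCount (suc m) i k → k ≡ codeCount m i
simple-braid-count {m} {i} {k} sc = begin
  k                       ≡⟨ sym repsLen ⟩
  length reps             ≡⟨ sym (length-map encode reps) ⟩
  length (map encode reps) ≡⟨ same-members⇒same-length codes-unique (Codes-unique m i) codes⊆ ⊆codes ⟩
  codeCount m i           ∎
  where
  open ≡-Reasoning
  open IsSimpleCount sc

  codes-unique : Unique (map encode reps)
  codes-unique = AllPairsₚ.map⁺ (allPairs-under repsOk
    (λ (u , _) (u′ , _) ¬eq same-code →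
       ¬eq (sameSignature⇒braidEq _ _ u u′ (encode-injective same-code)))
    distinct)

  codes⊆ : ∀ {c} → c ∈ map encode reps → c ∈ Codes m i
  codes⊆ c∈ with ∈-map⁻ encode c∈
  ... | r , r∈ , refl with All.lookup repsOk r∈
  ... | u , len = subst₂ (λ m′ i′ → encode r ∈ Codes m′ i′)
                    (encode-length r) (trans (weight-encode r u) len)
                    (Codes-complete (encode r) (encode-valid r))

  -- Every valid code is the code of its decoding, which is braid-equivalent to a representative.
  ⊆codes : ∀ {c} → c ∈ Codes m i → c ∈ map encode reps
  ⊆codes {c} c∈ with Codes-sound m i c∈
  ... | len , valid , wt with find (covers (decode m c) (decode-unique m c , trans (decode-length m c len) wt))
  ... | r , r∈ , w≈r = subst (_∈ map encode reps)
                          (trans (sym (encode-same (proj₂ (braidEq-preserves w≈r (decode-unique m c)))))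
                                 (encode-decode m c len valid))
                          (∈-map⁺ encode r∈)

-- A code of length m + 1 starts with absent followed by any code, or is headed.
codeCount-suc : ∀ m i → codeCount (suc m) i ≡ codeCount m i + length (Headed (suc m) i)
codeCount-suc m i =
  trans (length-++ (map (absent ∷_) (Codes m i)))
        (cong (_+ length (Headed (suc m) i)) (length-map (absent ∷_) (Codes m i)))

-- A headed code starts with present followed by any code, or with leads followed by a headed code.
headedCount-suc : ∀ m i → length (Headed (suc m) (suc i)) ≡ codeCount m i + length (Headed m i)
headedCount-suc m i =
  trans (length-++ (map (present ∷_) (Codes m i)))
        (cong₂ _+_ (length-map (present ∷_) (Codes m i)) (length-map (leads ∷_) (Headed m i)))

codeCountPred : ℕ → ℕ → ℕ
codeCountPred m zero = 0
codeCountPred m (suc j) = codeCount m j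

recurrence-arith : ∀ a b c d y → a ≡ c + (b + y) → b ≡ d + y → a + d ≡ 2 * b + c
recurrence-arith a b c d y refl refl =
  solve 3 (λ c d y → (c :+ ((d :+ y) :+ y)) :+ d := con 2 :* (d :+ y) :+ c) refl c d y
  where open +-*-Solver

code-recurrence : ∀ m i → codeCount (suc (suc m)) i + codeCountPred m i ≡
                          2 * codeCountPred (suc m) i + codeCount (suc m) i
code-recurrence m zero = trans (+-identityʳ _) (trans (codeCount-suc (suc m) zero) (+-identityʳ _))
code-recurrence m (suc j) =
  recurrence-arith _ _ _ _ (length (Headed (suc m) j))
    (trans (codeCount-suc (suc m) (suc j)) (cong (codeCount (suc m) (suc j) +_) (headedCount-suc (suc m) j)))
    (codeCount-suc m j)

simple-braid-count-pred : ∀ {m i k} → IsSimpleCountPred (suc m) i k → k ≡ codeCountPred m i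
simple-braid-count-pred {i = zero} k≡0 = k≡0
simple-braid-count-pred {i = suc j} sc = simple-braid-count sc

-- For n = m + 3 each of the four counts is a number of codes (simple-braid-count), and the
-- code recurrence holds for every i.
corollary4p2 : (n i : ℕ) → 3 ≤ n → i ≤ n ∸ 1 →
    (a b c d : ℕ) →
    IsSimpleCount n i a →
    IsSimpleCountPred (n ∸ 1) i b →
    IsSimpleCount (n ∸ 1) i c →
    IsSimpleCountPred (n ∸ 2) i d →
    a + d ≡ 2 * b + c
corollary4p2 (suc (suc (suc m))) i (s≤s (s≤s (s≤s _))) _ a b c d sₙ sₙ₋₁′ sₙ₋₁ sₙ₋₂′
  rewrite simple-braid-count sₙ | simple-braid-count-pred sₙ₋₁′
        | simple-braid-count sₙ₋₁ | simple-braid-count-pred sₙ₋₂′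
  = code-recurrence m i
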